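{- Let $P=([n],\preceq)$ be a chain, $w$ a weight on $\mathbb{F}_q$, $\pi(i)=k_i$ a label map with $N=k_1+\cdots+k_n$, and $\mathbb{C}\subseteq\mathbb{F}_q^N$ a code with $|\mathbb{C}|\ge2$ and minimum distance $d_{(P,w,\pi)}(\mathbb{C})$. Then $\sum_{i\in J}k_i\le N-\lceil\log_q|\mathbb{C}|\rceil$ for any ideal $J$ of $P$ with $|J|=\big\lfloor\frac{d_{(P,w,\pi)}(\mathbb{C})-1}{M_w}\big\rfloor$.
   Context: A weight on $\mathbb{F}_q$ is a map $w:\mathbb{F}_q\to\mathbb{N}\cup\{0\}$ with $w(\alpha)=0$ iff $\alpha=0$, $w(-\alpha)=w(\alpha)$, $w(\alpha+\beta)\le w(\alpha)+w(\beta)$; $M_w=\max_\alpha w(\alpha)$; $\tilde w^k(v)=\max_s w(v_s)$. Ideals of $P$ are down-closed subsets; $\langle A\rangle$ is the generated ideal. For $x=x_1\oplus\cdots\oplus x_n\in\mathbb{F}_q^{k_1}\oplus\cdots\oplus\mathbb{F}_q^{k_n}$, $supp_\pi(x)=\{i:x_i\ne0\}$, $I_x=\langle supp_\pi(x)\rangle$, $M_x$ its maximal elements, $w_{(P,w,\pi)}(x)=\sum_{i\in M_x}\tilde w^{k_i}(x_i)+|I_x\setminus M_x|\,M_w$, $d_{(P,w,\pi)}(x,y)=w_{(P,w,\pi)}(x-y)$, and $d_{(P,w,\pi)}(\mathbb{C})$ is the minimum distance between distinct codewords. -}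

module Defs where

open import Level using (0ℓ)
open import Data.Nat using (ℕ; zero; suc; _+_; _*_; _∸_; _^_; _≤_; _⊔_; NonZero)
open import Data.Nat.DivMod using (_/_)
open import Data.Bool using (Bool; true; false; _∧_; _∨_; not; if_then_else_)
open import Data.Fin using (Fin)
open import Data.Fin.Properties using () renaming (_≟_ to _≟ᶠ_)
open import Data.Fin.Subset using (Subset; _∈_)
open import Data.Vec using (lookup)
open import Data.Product using (Σ; _×_; ∃; _,_)
open import Data.List using (List; length)
open import Data.List.Membership.Propositional using () renaming (_∈_ to _∈ₗ_)
open import Data.List.Relation.Unary.AllPairs using (AllPairs)
open import Relation.Nullary using (¬_; Dec; yes; no)
open import Relation.Nullary.Decidable using (⌊_⌋)
open import Relation.Binary using (Rel; Decidable; IsDecTotalOrder)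
open import Relation.Binary.PropositionalEquality using (_≡_; _≢_)
open import Algebra.Structures using (IsCommutativeRing)
open import Function.Bundles using (_⤖_; Bijection)

record FiniteField : Set₁ where
  field
    Carrier : Set
    _+F_ : Carrier → Carrier → Carrier
    _*F_ : Carrier → Carrier → Carrier
    -F_  : Carrier → Carrier
    0F 1F : Carrier
    isCommutativeRing : IsCommutativeRing _≡_ _+F_ _*F_ -F_ 0F 1F
    0≢1 : 0F ≢ 1F
    inverse : ∀ x → x ≢ 0F → Σ Carrier λ y → x *F y ≡ 1F
    _≟F_ : Decidable {A = Carrier} _≡_
    q : ℕ
    enum : Fin q ⤖ Carrier

  _-F_ : Carrier → Carrier → Carrier
  x -F y = x +F (-F y)

sumFin : (n : ℕ) → (Fin n → ℕ) → ℕ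
sumFin zero    f = 0
sumFin (suc n) f = f Fin.zero + sumFin n (λ i → f (Fin.suc i))

maxFin : (n : ℕ) → (Fin n → ℕ) → ℕ
maxFin zero    f = 0
maxFin (suc n) f = f Fin.zero ⊔ maxFin n (λ i → f (Fin.suc i))

anyFin : (n : ℕ) → (Fin n → Bool) → Bool
anyFin zero    f = false
anyFin (suc n) f = f Fin.zero ∨ anyFin n (λ i → f (Fin.suc i))

-- floor division (a / b), with the convention a / 0 = 0 (never used:
-- M_w ≥ 1 for any weight on a field)
divℕ : ℕ → ℕ → ℕ
divℕ a zero    = 0
divℕ a (suc b) = a / suc b

IsCeilLog : ℕ → ℕ → ℕ → Set
IsCeilLog q m t = (m ≤ q ^ t) × (∀ s → m ≤ q ^ s → t ≤ s)

module _ (F : FiniteField) where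
  open FiniteField F

  record IsWeight (w : Carrier → ℕ) : Set where
    field
      zero-iff : ∀ α → (w α ≡ 0 → α ≡ 0F) × (α ≡ 0F → w α ≡ 0)
      symm     : ∀ α → w (-F α) ≡ w α
      triangle : ∀ α β → w (α +F β) ≤ w α + w β

  Mw : (Carrier → ℕ) → ℕ
  Mw w = maxFin q (λ j → w (Bijection.to enum j))

  wTilde : (w : Carrier → ℕ) (k : ℕ) → (Fin k → Carrier) → ℕ
  wTilde w k v = maxFin k (λ s → w (v s))

  -- Labeled poset block metric. P = (Fin n, ⪯) with decidable order,
  -- label map k (π(i) = k i); words of F_q^N, N = Σ k_i, are written as
  -- x = x_1 ⊕ ... ⊕ x_n with x_i ∈ F_q^{k_i}.

  Word : (n : ℕ) → (Fin n → ℕ) → Set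
  Word n k = (i : Fin n) → Fin (k i) → Carrier

  Distinct : {n : ℕ} (k : Fin n → ℕ) → Word n k → Word n k → Set
  Distinct k x y = ¬ (∀ i s → x i s ≡ y i s)

  module _ {n : ℕ} (k : Fin n → ℕ)
           (_⪯_ : Rel (Fin n) 0ℓ) (_⪯?_ : Decidable _⪯_) where

    _-W_ : Word n k → Word n k → Word n k
    (x -W y) i s = x i s -F y i s

    inSupp : Word n k → Fin n → Bool
    inSupp x i = anyFin (k i) (λ s → not ⌊ x i s ≟F 0F ⌋)

    inIdeal : Word n k → Fin n → Bool
    inIdeal x j = anyFin n (λ i → inSupp x i ∧ ⌊ j ⪯? i ⌋)

    isMax : Word n k → Fin n → Bool
    isMax x j = inIdeal x j ∧
      not (anyFin n (λ i → inIdeal x i ∧ ⌊ j ⪯? i ⌋ ∧ not ⌊ j ≟ᶠ i ⌋))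

    weightPWπ : (Carrier → ℕ) → Word n k → ℕ
    weightPWπ w x = sumFin n (λ i →
      if isMax x i then wTilde w (k i) (x i)
      else (if inIdeal x i then Mw w else 0))

    distPWπ : (Carrier → ℕ) → Word n k → Word n k → ℕ
    distPWπ w x y = weightPWπ w (x -W y)

    IsMinDistance : (Carrier → ℕ) → List (Word n k) → ℕ → Set
    IsMinDistance w C d =
      (∀ x y → x ∈ₗ C → y ∈ₗ C → Distinct k x y → d ≤ distPWπ w x y) ×
      Σ (Word n k) (λ x → Σ (Word n k) (λ y →
        x ∈ₗ C × y ∈ₗ C × Distinct k x y × distPWπ w x y ≡ d))

  IsIdeal : {n : ℕ} (_⪯_ : Rel (Fin n) 0ℓ) → Subset n → Set
  IsIdeal _⪯_ J = ∀ i j → j ⪯ i → i ∈ J → j ∈ J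

  sumOver : {n : ℕ} → Subset n → (Fin n → ℕ) → ℕ
  sumOver {n} J k = sumFin n (λ i → if lookup J i then k i else 0)

-- Let m be the dimension of the blocks outside J.  Two distinct codewords
-- cannot agree on those blocks: their difference would be supported in the
-- ideal J, so its weight is at most |J| M_w ≤ d − 1 < d.  Restriction to
-- the complement of J is therefore injective on C, whence |C| ≤ q^m, i.e.
-- ⌈log_q |C|⌉ ≤ m = N − Σ_{i∈J} k_i.
module Submission where

open import Defs
open import Level using (0ℓ)
open import Data.Nat using (ℕ; zero; suc; _+_; _*_; _∸_; _^_; _≤_; z≤n)
open import Data.Nat.Properties
  using (+-assoc; ≤-refl; ≤-trans; ≤-reflexive; +-mono-≤; m≤m⊔n; m≤n⊔m; ⊔-lub;
         m+n∸n≡m; ∸-monoʳ-≤; 1+n≰n; +-commutativeSemigroup; module ≤-Reasoning)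
open import Data.Nat.DivMod using (m/n*n≤m)
open import Algebra.Properties.CommutativeSemigroup +-commutativeSemigroup using (x∙yz≈y∙xz)
open import Data.Bool using (Bool; true; false; _∧_; if_then_else_)
open import Data.Fin using (Fin; _≟_; finToFun; funToFin)
open import Data.Fin.Properties using (injective⇒≤; finToFun-funToFin)
open import Data.Fin.Subset using (Subset; ∣_∣; ∁)
open import Data.Vec using ([]; _∷_; lookup)
open import Data.Vec.Properties using ([]=⇒lookup; lookup⇒[]=)
open import Data.Vec.Functional using (Vector; _++_)
open import Data.Vec.Functional.Properties using (++-injective)
open import Data.List using (List; length) renaming (lookup to lookupₗ)
open import Data.List.Membership.Propositional using () renaming (_∈_ to _∈ₗ_)
open import Data.List.Membership.Propositional.Properties using (∈-lookup)
open import Data.List.Relation.Unary.All as All using ()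
open import Data.List.Relation.Unary.Any using (here; there)
open import Data.List.Relation.Unary.AllPairs as AllPairs using (AllPairs; []; _∷_)
open import Data.Product using (Σ; _,_; proj₁; proj₂)
open import Data.Empty using (⊥-elim)
open import Relation.Nullary using (¬_; Dec; yes; no)
open import Relation.Nullary.Decidable using (⌊_⌋)
open import Relation.Binary using (Rel; Decidable; IsDecTotalOrder)
open import Relation.Binary.Definitions using (Symmetric)
open import Relation.Binary.PropositionalEquality
  using (_≡_; _≢_; _≗_; refl; sym; trans; cong; subst; module ≡-Reasoning)
open import Algebra.Structures using (IsCommutativeRing)
open import Function.Bundles using (Bijection; Surjection)

sumFin-mono : ∀ n {f g : Fin n → ℕ} → (∀ i → f i ≤ g i) → sumFin n f ≤ sumFin n g
sumFin-mono zero    f≤g = z≤n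
sumFin-mono (suc n) f≤g = +-mono-≤ (f≤g Fin.zero) (sumFin-mono n (λ i → f≤g (Fin.suc i)))

≤-maxFin : ∀ n (f : Fin n → ℕ) i → f i ≤ maxFin n f
≤-maxFin (suc n) f Fin.zero    = m≤m⊔n _ _
≤-maxFin (suc n) f (Fin.suc i) = ≤-trans (≤-maxFin n (λ j → f (Fin.suc j)) i) (m≤n⊔m _ _)

maxFin-lub : ∀ n {f : Fin n → ℕ} {c} → (∀ i → f i ≤ c) → maxFin n f ≤ c
maxFin-lub zero    f≤c = z≤n
maxFin-lub (suc n) f≤c = ⊔-lub (f≤c Fin.zero) (maxFin-lub n (λ i → f≤c (Fin.suc i)))

anyFin≡true⇒∃ : ∀ n (f : Fin n → Bool) → anyFin n f ≡ true → Σ (Fin n) λ i → f i ≡ true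
anyFin≡true⇒∃ (suc n) f any≡true with f Fin.zero in f0
... | true  = Fin.zero , f0
... | false with anyFin≡true⇒∃ n (λ i → f (Fin.suc i)) any≡true
...   | i , fi = Fin.suc i , fi

∧≡true⇒ˡ : ∀ {a b} → a ∧ b ≡ true → a ≡ true
∧≡true⇒ˡ {true} _ = refl

∧≡true⇒ʳ : ∀ {a b} → a ∧ b ≡ true → b ≡ true
∧≡true⇒ʳ {true} b≡true = b≡true

⌊⌋≡true⇒ : ∀ {A : Set} (a? : Dec A) → ⌊ a? ⌋ ≡ true → A
⌊⌋≡true⇒ (yes a) _ = a

if≤if : ∀ (a b : Bool) {V M : ℕ} → V ≤ M → (a ≡ true → b ≡ true) →
        (if a then V else (if b then M else 0)) ≤ (if b then M else 0)
if≤if true  true  V≤M _   = V≤M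
if≤if true  false _   a⇒b with a⇒b refl
... | ()
if≤if false true  _   _   = ≤-refl
if≤if false false _   _   = z≤n

if-mono : ∀ (b c : Bool) {M : ℕ} → (b ≡ true → c ≡ true) →
          (if b then M else 0) ≤ (if c then M else 0)
if-mono true  true  _   = ≤-refl
if-mono true  false b⇒c with b⇒c refl
... | ()
if-mono false _     _   = z≤n

divℕ-zeroˡ : ∀ M → divℕ 0 M ≡ 0
divℕ-zeroˡ zero    = refl
divℕ-zeroˡ (suc M) = refl

divℕ*≤ : ∀ a M → divℕ a M * M ≤ a
divℕ*≤ a zero    = z≤n
divℕ*≤ a (suc M) = m/n*n≤m a (suc M)

AllPairs-mapWith∈ : ∀ {A : Set} {R S : Rel A 0ℓ} {xs : List A} → AllPairs R xs →
                    (∀ {x y} → x ∈ₗ xs → y ∈ₗ xs → R x y → S x y) → AllPairs S xs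
AllPairs-mapWith∈ []         R⇒S = []
AllPairs-mapWith∈ (Rx ∷ Rxs) R⇒S =
  All.tabulate (λ y∈ → R⇒S (here refl) (there y∈) (All.lookup Rx y∈)) ∷
  AllPairs-mapWith∈ Rxs (λ x∈ y∈ → R⇒S (there x∈) (there y∈))

AllPairs-lookup : ∀ {A : Set} {R : Rel A 0ℓ} {xs : List A} → Symmetric R → AllPairs R xs →
                  ∀ {i j} → i ≢ j → R (lookupₗ xs i) (lookupₗ xs j)
AllPairs-lookup sym-R (Rx ∷ Rxs) {Fin.zero}  {Fin.zero}  i≢j = ⊥-elim (i≢j refl)
AllPairs-lookup sym-R (Rx ∷ Rxs) {Fin.zero}  {Fin.suc j} _   = All.lookup Rx (∈-lookup j)
AllPairs-lookup sym-R (Rx ∷ Rxs) {Fin.suc i} {Fin.zero}  _   = sym-R (All.lookup Rx (∈-lookup i))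
AllPairs-lookup sym-R (Rx ∷ Rxs) {Fin.suc i} {Fin.suc j} i≢j =
  AllPairs-lookup sym-R Rxs (λ i≡j → i≢j (cong Fin.suc i≡j))

distinctImages⇒length≤ : ∀ {A : Set} {c} {xs : List A} (g : A → Fin c) →
                         AllPairs (λ x y → g x ≢ g y) xs → length xs ≤ c
distinctImages⇒length≤ {xs = xs} g distinct = injective⇒≤ injective
  where
  injective : ∀ {i j} → g (lookupₗ xs i) ≡ g (lookupₗ xs j) → i ≡ j
  injective {i} {j} gi≡gj with i ≟ j
  ... | yes i≡j = i≡j
  ... | no  i≢j = ⊥-elim (AllPairs-lookup (λ ne eq → ne (sym eq)) distinct i≢j gi≡gj)

module _ (F : FiniteField) where
  open FiniteField F
  open Surjection (Bijection.surjection enum) using (to; to⁻; to∘to⁻)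

  w≤Mw : (w : Carrier → ℕ) (α : Carrier) → w α ≤ Mw F w
  w≤Mw w α = subst (λ β → w β ≤ Mw F w) (to∘to⁻ α) (≤-maxFin q (λ j → w (to j)) (to⁻ α))

  wTilde≤Mw : (w : Carrier → ℕ) (m : ℕ) (v : Fin m → Carrier) → wTilde F w m v ≤ Mw F w
  wTilde≤Mw w m v = maxFin-lub m (λ s → w≤Mw w (v s))

  encode : ∀ {m} → Vector Carrier m → Fin (q ^ m)
  encode v = funToFin (λ r → to⁻ (v r))

  encode-injective : ∀ {m} (u v : Vector Carrier m) → encode u ≡ encode v → u ≗ v
  encode-injective u v eq r = begin
    u r                                          ≡⟨ sym (to∘to⁻ (u r)) ⟩
    to (to⁻ (u r))                               ≡⟨ cong to (sym (finToFun-funToFin (λ s → to⁻ (u s)) r)) ⟩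
    to (finToFun (encode u) r)                   ≡⟨ cong (λ c → to (finToFun c r)) eq ⟩
    to (finToFun (encode v) r)                   ≡⟨ cong to (finToFun-funToFin (λ s → to⁻ (v s)) r) ⟩
    to (to⁻ (v r))                               ≡⟨ to∘to⁻ (v r) ⟩
    v r                                          ∎
    where open ≡-Reasoning

  separated⇒length≤q^ : ∀ {A : Set} {m} {xs : List A} (f : A → Vector Carrier m) →
                        AllPairs (λ x y → ¬ f x ≗ f y) xs → length xs ≤ q ^ m
  separated⇒length≤q^ f separated =
    distinctImages⇒length≤ (λ x → encode (f x))
      (AllPairs.map (λ {x} {y} ¬f≗ eq → ¬f≗ (encode-injective (f x) (f y) eq)) separated)

  sumOver-const : ∀ {n} (J : Subset n) (c : ℕ) → sumOver F J (λ _ → c) ≡ ∣ J ∣ * c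
  sumOver-const []          c = refl
  sumOver-const (true ∷ J)  c = cong (c +_) (sumOver-const J c)
  sumOver-const (false ∷ J) c = sumOver-const J c

  sumOver-empty : ∀ {n} (J : Subset n) (k : Fin n → ℕ) → ∣ J ∣ ≡ 0 → sumOver F J k ≡ 0
  sumOver-empty []          k _     = refl
  sumOver-empty (false ∷ J) k ∣J∣≡0 = sumOver-empty J (λ i → k (Fin.suc i)) ∣J∣≡0

  sumOver-+-∁ : ∀ {n} (J : Subset n) (k : Fin n → ℕ) →
                sumOver F J k + sumOver F (∁ J) k ≡ sumFin n k
  sumOver-+-∁ [] k = refl
  sumOver-+-∁ (true ∷ J) k =
    trans (+-assoc (k Fin.zero) (sumOver F J k′) (sumOver F (∁ J) k′))
          (cong (k Fin.zero +_) (sumOver-+-∁ J k′))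
    where k′ = λ i → k (Fin.suc i)
  sumOver-+-∁ (false ∷ J) k =
    trans (x∙yz≈y∙xz (sumOver F J k′) (k Fin.zero) (sumOver F (∁ J) k′))
          (cong (k Fin.zero +_) (sumOver-+-∁ J k′))
    where k′ = λ i → k (Fin.suc i)

  restrict∁ : ∀ {n} (k : Fin n → ℕ) (J : Subset n) → Word F n k → Vector Carrier (sumOver F (∁ J) k)
  restrict∁ k []          x ()
  restrict∁ k (true ∷ J)  x = restrict∁ (λ i → k (Fin.suc i)) J (λ i → x (Fin.suc i))
  restrict∁ k (false ∷ J) x = x Fin.zero ++ restrict∁ (λ i → k (Fin.suc i)) J (λ i → x (Fin.suc i))

  restrict∁-≗ : ∀ {n} (k : Fin n → ℕ) (J : Subset n) (x y : Word F n k) →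
                restrict∁ k J x ≗ restrict∁ k J y → ∀ i → lookup J i ≡ false → x i ≗ y i
  restrict∁-≗ k (true ∷ J)  x y eq (Fin.suc i) i∉J =
    restrict∁-≗ _ J _ _ eq i i∉J
  restrict∁-≗ k (false ∷ J) x y eq Fin.zero    _   =
    proj₁ (++-injective (x Fin.zero) (y Fin.zero) eq)
  restrict∁-≗ k (false ∷ J) x y eq (Fin.suc i) i∉J =
    restrict∁-≗ _ J _ _ (proj₂ (++-injective (x Fin.zero) (y Fin.zero) eq)) i i∉J

  IsIdeal-lookup : ∀ {n} {_⪯_ : Rel (Fin n) 0ℓ} {J : Subset n} → IsIdeal F _⪯_ J →
                   ∀ {i j} → j ⪯ i → lookup J i ≡ true → lookup J j ≡ true
  IsIdeal-lookup {J = J} ideal {i} {j} j⪯i i∈J =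
    []=⇒lookup (ideal i j j⪯i (lookup⇒[]= i J i∈J))

  SupportedIn : ∀ {n} (k : Fin n → ℕ) → Subset n → Word F n k → Set
  SupportedIn k J z = ∀ i → lookup J i ≡ false → ∀ s → z i s ≡ 0F

  module _ {n : ℕ} (k : Fin n → ℕ) (_⪯_ : Rel (Fin n) 0ℓ) (_⪯?_ : Decidable _⪯_) where

    agree⇒-W-supportedIn : ∀ {J : Subset n} (x y : Word F n k) →
                           (∀ i → lookup J i ≡ false → x i ≗ y i) →
                           SupportedIn k J (_-W_ F k _⪯_ _⪯?_ x y)
    agree⇒-W-supportedIn x y agree i i∉J s =
      trans (cong (_-F y i s) (agree i i∉J s))
            (IsCommutativeRing.-‿inverseʳ isCommutativeRing (y i s))

    module _ {J : Subset n} {z : Word F n k} (supported : SupportedIn k J z) where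

      inSupp⇒∈ : ∀ {i} → inSupp F k _⪯_ _⪯?_ z i ≡ true → lookup J i ≡ true
      inSupp⇒∈ {i} i∈supp with lookup J i in J[i]
      ... | true  = refl
      ... | false with anyFin≡true⇒∃ (k i) _ i∈supp
      -- the yes case is absurd because nonzero then reads not true ≡ true
      ...   | s , nonzero with z i s ≟F 0F
      ...     | no zis≢0 = ⊥-elim (zis≢0 (supported i J[i] s))

      inIdeal⇒∈ : IsIdeal F _⪯_ J → ∀ {i} → inIdeal F k _⪯_ _⪯?_ z i ≡ true → lookup J i ≡ true
      inIdeal⇒∈ ideal {i} i∈I with anyFin≡true⇒∃ n _ i∈I
      ... | j , j∈supp∧i⪯j =
        IsIdeal-lookup ideal (⌊⌋≡true⇒ (i ⪯? j) (∧≡true⇒ʳ j∈supp∧i⪯j)) (inSupp⇒∈ (∧≡true⇒ˡ j∈supp∧i⪯j))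

      -- Each block contributes at most M_w, and only blocks in I_z ⊆ J contribute.
      weight-supportedIn : (w : Carrier → ℕ) → IsIdeal F _⪯_ J →
                           weightPWπ F k _⪯_ _⪯?_ w z ≤ ∣ J ∣ * Mw F w
      weight-supportedIn w ideal = begin
        weightPWπ F k _⪯_ _⪯?_ w z ≤⟨ sumFin-mono n block≤ ⟩
        sumOver F J (λ _ → Mw F w) ≡⟨ sumOver-const J (Mw F w) ⟩
        ∣ J ∣ * Mw F w             ∎
        where
        open ≤-Reasoning
        block≤ : ∀ i → (if isMax F k _⪯_ _⪯?_ z i then wTilde F w (k i) (z i)
                        else (if inIdeal F k _⪯_ _⪯?_ z i then Mw F w else 0))
                       ≤ (if lookup J i then Mw F w else 0)
        block≤ i = ≤-trans
          (if≤if (isMax F k _⪯_ _⪯?_ z i) _ (wTilde≤Mw w (k i) (z i)) ∧≡true⇒ˡ)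
          (if-mono _ (lookup J i) (inIdeal⇒∈ ideal))

    restrict∁-separates : ∀ (w : Carrier → ℕ) {C : List (Word F n k)} {d} {J : Subset n} →
                          IsMinDistance F k _⪯_ _⪯?_ w C (suc d) → IsIdeal F _⪯_ J →
                          ∣ J ∣ * Mw F w ≤ d → AllPairs (Distinct F k) C →
                          AllPairs (λ x y → ¬ restrict∁ k J x ≗ restrict∁ k J y) C
    restrict∁-separates w {d = d} {J} (d≤dist , _) ideal ∣J∣Mw≤d distinct =
      AllPairs-mapWith∈ distinct λ {x} {y} x∈C y∈C x≢y agree → 1+n≰n (begin
        suc d                         ≤⟨ d≤dist x y x∈C y∈C x≢y ⟩
        distPWπ F k _⪯_ _⪯?_ w x y    ≤⟨ weight-supportedIn
                                           (agree⇒-W-supportedIn {J} x y (restrict∁-≗ k J x y agree))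
                                           w ideal ⟩
        ∣ J ∣ * Mw F w                ≤⟨ ∣J∣Mw≤d ⟩
        d                             ∎)
      where open ≤-Reasoning

theorem5p1 : (F : FiniteField) → (w : FiniteField.Carrier F → ℕ) → IsWeight F w →
    (n : ℕ) (_⪯_ : Rel (Fin n) 0ℓ) (isChain : IsDecTotalOrder _≡_ _⪯_) →
    (k : Fin n → ℕ) →
    (C : List (Word F n k)) → AllPairs (Distinct F k) C →
    2 ≤ length C →
    (d : ℕ) → IsMinDistance F k _⪯_ (IsDecTotalOrder._≤?_ isChain) w C d →
    (J : Subset n) → IsIdeal F _⪯_ J →
    ∣ J ∣ ≡ divℕ (d ∸ 1) (Mw F w) →
    (t : ℕ) → IsCeilLog (FiniteField.q F) (length C) t →
    sumOver F J k ≤ sumFin n k ∸ t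
theorem5p1 F w _ _ _ _ k _ _ _ zero _ J _ ∣J∣≡ _ _
  rewrite sumOver-empty F J k (trans ∣J∣≡ (divℕ-zeroˡ (Mw F w))) = z≤n
theorem5p1 F w _ n _⪯_ isChain k C distinct _ (suc d) minDist J ideal ∣J∣≡ t (_ , least) = begin
  sumOver F J k                                  ≡⟨ sym (m+n∸n≡m (sumOver F J k) m) ⟩
  sumOver F J k + m ∸ m                          ≡⟨ cong (_∸ m) (sumOver-+-∁ F J k) ⟩
  sumFin n k ∸ m                                 ≤⟨ ∸-monoʳ-≤ (sumFin n k) (least m |C|≤q^m) ⟩
  sumFin n k ∸ t                                 ∎
  where
  open ≤-Reasoning
  m = sumOver F (∁ J) k
  ∣J∣Mw≤d : ∣ J ∣ * Mw F w ≤ d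
  ∣J∣Mw≤d = ≤-trans (≤-reflexive (cong (_* Mw F w) ∣J∣≡)) (divℕ*≤ d (Mw F w))
  |C|≤q^m : length C ≤ FiniteField.q F ^ m
  |C|≤q^m = separated⇒length≤q^ F (restrict∁ F k J)
    (restrict∁-separates F k _⪯_ (IsDecTotalOrder._≤?_ isChain) w minDist ideal ∣J∣Mw≤d distinct)
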